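{- Let $c$ be a Coxeter element of $A_n$ and let $w$ be a $c$-singleton such that $1\in f(w)$. Define a decreasing sequence $a_0>a_1>\cdots>a_{2k}$ ($k\ge0$) as follows: $a_0$ is the largest element of $f(w)$; given $a_{2(i-1)}$, if $\{1,\dots,a_{2(i-1)}\}\subseteq f(w)$ stop (with $k=i-1$); otherwise let $a_{2i-1}$ be the largest integer $<a_{2(i-1)}$ not in $f(w)$ and $a_{2i}$ the largest integer $<a_{2i-1}$ in $f(w)$. Then $$X(w)=X(b_{a_0})-\sum_{i=1}^{k}\big[X(b_{a_{2i-1}})-X(b_{a_{2i}})\big].$$
   Context: $A_n$ is the symmetric group on $[n+1]$, $s_i$ exchanges $i,i+1$, permutations compose as functions; $X(w)$ is the $(n+1)\times(n+1)$ matrix with $1$ in position $(i,w(i))$ and $0$ elsewhere. A Coxeter element is $c=s_{a_1}\cdots s_{a_n}$ with $(a_1,\dots,a_n)$ a permutation of $[n]$. $\mathrm{sort}_c(w)$ is the lexicographically first subword of $c^\infty$ that is a reduced word for $w$; $w$ is $c$-sortable if the sets $K_j$ of letters of $\mathrm{sort}_c(w)$ from the $j$-th copy satisfy $K_1\supseteq K_2\supseteq\cdots$; $\pi^c_\downarrow(w)$ is the largest $c$-sortable element weakly below $w$ in right weak order; a $c$-singleton is a $c$-sortable $w$ with $(\pi^c_\downarrow)^{ -1}(w)=\{w\}$. For $i\in\{2,\dots,n\}$, $i$ is lower-barred if $i-1$ precedes $i$ in $(a_1,\dots,a_n)$, upper-barred otherwise; $d_1<\dots<d_r$ are the lower-barred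 and $u_1<\dots<u_s$ the upper-barred numbers. Let $N=\binom{n+1}{2}$, and let $R_c=[R(1)\cdots R(N)]$ be the word $[(d_1-1)\cdots1]\cdots[(d_r-1)\cdots1][n\cdots1][n\cdots(n-u_s+2)]\cdots[n\cdots(n-u_1+2)]$ (each bracket a decreasing run). $H_c$ is its heap: the poset on $\{1,\dots,N\}$ generated by $x\prec y$ whenever $x<y$ and $|R(x)-R(y)|\le1$. $b_i=s_{R(1)}\cdots s_{R(i)}$. The map sending an order ideal $I=\{z_1<\cdots<z_m\}$ of $H_c$ to $s_{R(z_1)}\cdots s_{R(z_m)}$ is a bijection onto the $c$-singletons; $f(w)\subseteq\{1,\dots,N\}$ denotes the order ideal corresponding to $w$. -}

module Defs where

open import Data.Nat using (ℕ; zero; suc; _+_; _∸_; _≤_; _<_; _<ᵇ_; _≡ᵇ_; ∣_-_∣)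
open import Data.Bool using (Bool; true; false; if_then_else_; not)
open import Data.List using (List; []; _∷_; _++_; map; concat; reverse; upTo; applyUpTo; filterᵇ; foldr; take; length)
open import Data.Nat.ListAction using (sum)
open import Data.Maybe using (Maybe; just; nothing)
open import Data.Product using (_×_; _,_)
open import Data.Fin using (Fin; toℕ)
open import Data.Integer using (ℤ; +_; _-_)
open import Function using (id; _∘_)
open import Relation.Binary.Construct.Closure.Transitive using (TransClosure)

-- Points of [n+1] are the naturals 1 .. n+1; a permutation is represented by
-- its action ℕ → ℕ (identity outside [n+1]).

s : ℕ → ℕ → ℕ
s k x = if x ≡ᵇ k then suc k else (if x ≡ᵇ suc k then k else x)

prod : List ℕ → ℕ → ℕ
prod = foldr (λ r f → s r ∘ f) id

-- permutation matrix X(w): entry (i , w(i)) is 1, others 0 (rows/cols indexed by Fin (n+1), i ↦ i+1)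
X : (n : ℕ) → (ℕ → ℕ) → Fin (suc n) → Fin (suc n) → ℤ
X n w i j = if w (suc (toℕ i)) ≡ᵇ suc (toℕ j) then + 1 else + 0

pos : List ℕ → ℕ → ℕ
pos [] x = 0
pos (y ∷ ys) x = if y ≡ᵇ x then 0 else suc (pos ys x)

lowerBarred : List ℕ → ℕ → Bool
lowerBarred a i = pos a (i ∸ 1) <ᵇ pos a i

twoToN : ℕ → List ℕ
twoToN n = applyUpTo (λ j → j + 2) (n ∸ 1)

lowers : ℕ → List ℕ → List ℕ
lowers n a = filterᵇ (lowerBarred a) (twoToN n)

uppers : ℕ → List ℕ → List ℕ
uppers n a = filterᵇ (not ∘ lowerBarred a) (twoToN n)

down : ℕ → List ℕ
down k = map (λ j → k ∸ j) (upTo k)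

upRun : ℕ → ℕ → List ℕ
upRun n u = map (λ j → n ∸ j) (upTo (u ∸ 1))

Rword : ℕ → List ℕ → List ℕ
Rword n a = concat (map (λ d → down (d ∸ 1)) (lowers n a))
            ++ down n
            ++ concat (map (upRun n) (reverse (uppers n a)))

Nn : ℕ → ℕ
Nn n = sum (upTo (suc n))

-- 1-based lookup (default 0 outside the range)
nth1 : List ℕ → ℕ → ℕ
nth1 [] x = 0
nth1 (y ∷ ys) zero = 0
nth1 (y ∷ ys) (suc zero) = y
nth1 (y ∷ ys) (suc (suc k)) = nth1 ys (suc k)

R : ℕ → List ℕ → ℕ → ℕ
R n a x = nth1 (Rword n a) x

heapGen : ℕ → List ℕ → ℕ → ℕ → Set
heapGen n a x y = (1 ≤ x) × (x < y) × (y ≤ Nn n) × (∣ R n a x - R n a y ∣ ≤ 1)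

heapLt : ℕ → List ℕ → ℕ → ℕ → Set
heapLt n a = TransClosure (heapGen n a)

IsOrderIdeal : ℕ → List ℕ → (ℕ → Bool) → Set
IsOrderIdeal n a I =
  ((x : ℕ) → I x ≡ true → (1 ≤ x) × (x ≤ Nn n)) ×
  ((x y : ℕ) → heapLt n a x y → I y ≡ true → I x ≡ true)
  where open import Relation.Binary.PropositionalEquality using (_≡_)

-- the c-singleton s_{R(z_1)} ... s_{R(z_m)} corresponding to I = {z_1 < ... < z_m}
singletonOf : ℕ → List ℕ → (ℕ → Bool) → ℕ → ℕ
singletonOf n a I = prod (map (R n a) (filterᵇ I (applyUpTo suc (Nn n))))

b : ℕ → List ℕ → ℕ → ℕ → ℕ
b n a i = prod (take i (Rword n a))

allIn : (ℕ → Bool) → ℕ → Bool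
allIn I zero = true
allIn I (suc m) = if I (suc m) then allIn I m else false

findBelow : (ℕ → Bool) → ℕ → Maybe ℕ
findBelow p zero = nothing
findBelow p (suc m) = if p m then just m else findBelow p m

-- the pairs (a_{2i-1}, a_{2i}) for i = 1..k, starting from a_{2(i-1)} = cur;
-- fuel bounds the number of steps (the sequence strictly decreases, so fuel a_0 suffices)
steps : ℕ → (ℕ → Bool) → ℕ → List (ℕ × ℕ)
steps zero I cur = []
steps (suc fuel) I cur with allIn I cur
... | true = []
... | false with findBelow (not ∘ I) cur
...   | nothing = []
...   | just odd with findBelow I odd
...     | nothing = []
...     | just even = (odd , even) ∷ steps fuel I even

-- the sequence a_0 > a_1 > ... > a_{2k}, as the list of pairs (a_{2i-1}, a_{2i})
oddEven : (ℕ → Bool) → ℕ → List (ℕ × ℕ)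
oddEven I a0 = steps a0 I a0

corr : (n : ℕ) → List ℕ → List (ℕ × ℕ) → Fin (suc n) → Fin (suc n) → ℤ
corr n a [] i j = + 0
corr n a ((p , q) ∷ ps) i j = (X n (b n a p) i j - X n (b n a q) i j) Data.Integer.+ corr n a ps i j

{-# OPTIONS --safe #-}

-- Split the letters of b_m = s_{R(1)} ⋯ s_{R(m)} into those at positions in I, with product W_m,
-- and the others, with product V_m.  A letter outside I commutes with every later letter inside I
-- (otherwise the heap relation would force its position into I), so b_m = W_m V_m and V_m fixes
-- both points moved by each later letter of I.  Hence the row discrepancy
-- D_m(p) = [b_m(p) = q] − [W_m(p) = q] vanishes where V_m does not move p; a letter s_r at a
-- position in I therefore leaves D unchanged (D_{m+1}(p) = D_m(s_r p) and D_m vanishes at r, r+1),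
-- while a letter outside I adds [b_{m+1}(p) = q] − [b_m(p) = q].  Summing up to a_0, D telescopes
-- over the maximal runs a_{2i} < k ≤ a_{2i−1} of positions outside I, and W_{a_0} = w because a_0
-- is the largest element of I.

module Submission where

open import Defs
open import Data.Nat using (ℕ; zero; suc; _≤_; _<_; _+_; _∸_; _≡ᵇ_; ∣_-_∣; z≤n; s≤s; _≤′_; ≤′-refl; ≤′-step; _≟_)
open import Data.Nat.Properties
  using (≡ᵇ⇒≡; 1+n≢n; suc-injective; ∣n-n∣≡0; ∣-∣-comm; ≤-refl; ≤-reflexive; ≤-trans; <⇒≤;
         n<1+n; m≤n⇒m≤1+n; m<1+n⇒m≤n; m≤n⇒m<n∨m≡n; m<1+n⇒m<n∨m≡n; <⇒≱; <-trans; <-≤-trans;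
         ≤⇒≤′; ≤′⇒≤; +-comm; +-assoc; +-identityʳ)
open import Data.Nat.ListAction using (sum)
open import Data.Nat.ListAction.Properties using (sum-++; sum-↭)
open import Data.Bool using (Bool; true; false; not; if_then_else_; T)
open import Data.Bool.Properties using (not-injective; not-¬)
open import Data.List
  using (List; []; _∷_; _++_; [_]; map; upTo; take; length; applyUpTo; filterᵇ; concat; reverse)
open import Data.List.Properties
  using (map-++; length-++; length-map; length-upTo; upTo-∷ʳ; applyUpTo-∷ʳ; map-upTo; map-applyUpTo;
         map-cong; filter-++)
open import Data.List.Relation.Binary.Permutation.Propositional using (_↭_)
open import Data.List.Relation.Binary.Permutation.Propositional.Properties using (↭-reverse; map⁺)
open import Data.Maybe using (just; nothing)
open import Data.Product using (_×_; _,_; proj₁; proj₂)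
open import Data.Sum using (inj₁; inj₂)
open import Data.Fin using (Fin; toℕ)
open import Data.Integer as ℤ using (ℤ; 0ℤ; 1ℤ; _-_)
open import Data.Integer.Properties using (+-inverseʳ; +-identityˡ)
import Data.Integer.Tactic.RingSolver as ℤ-Solver
open import Function using (_∘_)
open import Function.Definitions using (Injective)
open import Relation.Nullary using (¬_; yes; no; contradiction)
open import Relation.Nullary.Decidable using (T?)
open import Relation.Binary.PropositionalEquality
  using (_≡_; _≢_; _≗_; refl; sym; trans; cong; cong₂; subst; module ≡-Reasoning)
open import Relation.Binary.Construct.Closure.Transitive using () renaming ([_] to [_]⁺)

open ≡-Reasoning

≡ᵇ-refl : ∀ m → (m ≡ᵇ m) ≡ true
≡ᵇ-refl zero = refl
≡ᵇ-refl (suc m) = ≡ᵇ-refl m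

≢⇒≡ᵇ-false : ∀ {m n} → m ≢ n → (m ≡ᵇ n) ≡ false
≢⇒≡ᵇ-false {m} {n} m≢n with m ≡ᵇ n in eq
... | false = refl
... | true = contradiction (≡ᵇ⇒≡ m n (subst T (sym eq) _)) m≢n

s-left : ∀ r → s r r ≡ suc r
s-left r rewrite ≡ᵇ-refl r = refl

s-right : ∀ r → s r (suc r) ≡ r
s-right r rewrite ≢⇒≡ᵇ-false (1+n≢n {r}) | ≡ᵇ-refl r = refl

s-fix : ∀ {r x} → x ≢ r → x ≢ suc r → s r x ≡ x
s-fix x≢r x≢1+r rewrite ≢⇒≡ᵇ-false x≢r | ≢⇒≡ᵇ-false x≢1+r = refl

s-invariant : ∀ {A : Set} (f : ℕ → A) r → f r ≡ f (suc r) → ∀ x → f (s r x) ≡ f x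
s-invariant f r fr≡f1+r x with x ≟ r | x ≟ suc r
... | yes refl | _        = trans (cong f (s-left r)) (sym fr≡f1+r)
... | no _     | yes refl = trans (cong f (s-right r)) fr≡f1+r
... | no x≢r   | no x≢1+r = cong f (s-fix x≢r x≢1+r)

s-involutive : ∀ r x → s r (s r x) ≡ x
s-involutive r x with x ≟ r | x ≟ suc r
... | yes refl | _        = trans (cong (s r) (s-left r)) (s-right r)
... | no _     | yes refl = trans (cong (s r) (s-right r)) (s-left r)
... | no x≢r   | no x≢1+r rewrite s-fix x≢r x≢1+r = s-fix x≢r x≢1+r

s-injective : ∀ r → Injective _≡_ _≡_ (s r)
s-injective r {x} {y} sx≡sy = begin
  x             ≡⟨ s-involutive r x ⟨
  s r (s r x)   ≡⟨ cong (s r) sx≡sy ⟩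
  s r (s r y)   ≡⟨ s-involutive r y ⟩
  y             ∎

record FixesSupport (f : ℕ → ℕ) (r : ℕ) : Set where
  constructor fixes
  field
    fixes-r : f r ≡ r
    fixes-1+r : f (suc r) ≡ suc r

fixesSupport-∘ : ∀ {f g r} → FixesSupport f r → FixesSupport g r → FixesSupport (f ∘ g) r
fixesSupport-∘ {f} (fixes f₀ f₁) (fixes g₀ g₁) = fixes (trans (cong f g₀) f₀) (trans (cong f g₁) f₁)

fixesSupport-resp : ∀ {f g r} → f ≗ g → FixesSupport g r → FixesSupport f r
fixesSupport-resp f≗g (fixes g₀ g₁) = fixes (trans (f≗g _) g₀) (trans (f≗g _) g₁)

commutes-with-s : ∀ {Γ r} → Injective _≡_ _≡_ Γ → FixesSupport Γ r → ∀ x → Γ (s r x) ≡ s r (Γ x)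
commutes-with-s {Γ} {r} Γ-inj (fixes Γr≡r Γ1+r≡1+r) x with x ≟ r | x ≟ suc r
... | yes refl | _ = begin
  Γ (s r r)    ≡⟨ cong Γ (s-left r) ⟩
  Γ (suc r)    ≡⟨ Γ1+r≡1+r ⟩
  suc r        ≡⟨ s-left r ⟨
  s r r        ≡⟨ cong (s r) Γr≡r ⟨
  s r (Γ r)    ∎
... | no _ | yes refl = begin
  Γ (s r (suc r))  ≡⟨ cong Γ (s-right r) ⟩
  Γ r              ≡⟨ Γr≡r ⟩
  r                ≡⟨ s-right r ⟨
  s r (suc r)      ≡⟨ cong (s r) Γ1+r≡1+r ⟨
  s r (Γ (suc r))  ∎
... | no x≢r | no x≢1+r = begin
  Γ (s r x)    ≡⟨ cong Γ (s-fix x≢r x≢1+r) ⟩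
  Γ x          ≡⟨ s-fix (λ Γx≡r → x≢r (Γ-inj (trans Γx≡r (sym Γr≡r))))
                        (λ Γx≡1+r → x≢1+r (Γ-inj (trans Γx≡1+r (sym Γ1+r≡1+r)))) ⟨
  s r (Γ x)    ∎

∣n-1+n∣≡1 : ∀ n → ∣ n - suc n ∣ ≡ 1
∣n-1+n∣≡1 zero = refl
∣n-1+n∣≡1 (suc n) = ∣n-1+n∣≡1 n

far⇒s-fixes : ∀ t r → ¬ ∣ t - r ∣ ≤ 1 → FixesSupport (s t) r
far⇒s-fixes t r far = fixes (s-fix r≢t r≢1+t) (s-fix 1+r≢t (r≢t ∘ suc-injective))
  where
  r≢t : r ≢ t
  r≢t refl = far (≤-trans (≤-reflexive (∣n-n∣≡0 r)) z≤n)
  r≢1+t : r ≢ suc t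
  r≢1+t refl = far (≤-reflexive (∣n-1+n∣≡1 t))
  1+r≢t : suc r ≢ t
  1+r≢t refl = far (≤-reflexive (trans (∣-∣-comm (suc r) r) (∣n-1+n∣≡1 r)))

prod-++ : ∀ xs ys x → prod (xs ++ ys) x ≡ prod xs (prod ys x)
prod-++ [] ys x = refl
prod-++ (r ∷ xs) ys x = cong (s r) (prod-++ xs ys x)

prod-injective : ∀ ts → Injective _≡_ _≡_ (prod ts)
prod-injective [] eq = eq
prod-injective (t ∷ ts) eq = prod-injective ts (s-injective t eq)

prod-take-suc : ∀ w m → suc m ≤ length w →
                ∀ x → prod (take (suc m) w) x ≡ prod (take m w) (s (nth1 w (suc m)) x)
prod-take-suc (t ∷ w) zero _ x = refl
prod-take-suc (t ∷ w) (suc m) (s≤s m<∣w∣) x = cong (s t) (prod-take-suc w m m<∣w∣ x)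

subwordProd : List ℕ → (ℕ → Bool) → ℕ → ℕ → ℕ
subwordProd w P m = prod (map (nth1 w) (filterᵇ P (applyUpTo suc m)))

subwordProd-injective : ∀ w P m → Injective _≡_ _≡_ (subwordProd w P m)
subwordProd-injective w P m = prod-injective (map (nth1 w) (filterᵇ P (applyUpTo suc m)))

subwordProd-suc : ∀ w P m x →
  subwordProd w P (suc m) x ≡ subwordProd w P m (prod (map (nth1 w) (filterᵇ P [ suc m ])) x)
subwordProd-suc w P m x = begin
  prod (map (nth1 w) (filterᵇ P (applyUpTo suc (suc m)))) x
    ≡⟨ cong (λ ks → prod (map (nth1 w) (filterᵇ P ks)) x) (applyUpTo-∷ʳ suc m) ⟨
  prod (map (nth1 w) (filterᵇ P (applyUpTo suc m ++ [ suc m ]))) x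
    ≡⟨ cong (λ ks → prod (map (nth1 w) ks) x) (filter-++ (T? ∘ P) (applyUpTo suc m) [ suc m ]) ⟩
  prod (map (nth1 w) (filterᵇ P (applyUpTo suc m) ++ filterᵇ P [ suc m ])) x
    ≡⟨ cong (λ ts → prod ts x) (map-++ (nth1 w) (filterᵇ P (applyUpTo suc m)) _) ⟩
  prod (map (nth1 w) (filterᵇ P (applyUpTo suc m)) ++ map (nth1 w) (filterᵇ P [ suc m ])) x
    ≡⟨ prod-++ (map (nth1 w) (filterᵇ P (applyUpTo suc m))) _ x ⟩
  subwordProd w P m (prod (map (nth1 w) (filterᵇ P [ suc m ])) x) ∎

subwordProd-accept : ∀ w P {m} → P (suc m) ≡ true → ∀ x →
                     subwordProd w P (suc m) x ≡ subwordProd w P m (s (nth1 w (suc m)) x)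
subwordProd-accept w P {m} P[1+m] x with subwordProd-suc w P m x
... | eq rewrite P[1+m] = eq

subwordProd-reject : ∀ w P {m} → P (suc m) ≡ false → ∀ x → subwordProd w P (suc m) x ≡ subwordProd w P m x
subwordProd-reject w P {m} ¬P[1+m] x with subwordProd-suc w P m x
... | eq rewrite ¬P[1+m] = eq

subwordProd-beyond : ∀ w P {m m′} → (∀ k → P k ≡ true → k ≤ m) → m ≤ m′ →
                     ∀ x → subwordProd w P m′ x ≡ subwordProd w P m x
subwordProd-beyond w P {m} bounded m≤m′ = go (≤⇒≤′ m≤m′)
  where
  outside : ∀ {k} → m < k → P k ≡ false
  outside {k} m<k with P k in Pk
  ... | true = contradiction (bounded k Pk) (<⇒≱ m<k)
  ... | false = refl
  go : ∀ {m′} → m ≤′ m′ → ∀ x → subwordProd w P m′ x ≡ subwordProd w P m x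
  go ≤′-refl x = refl
  go (≤′-step m≤′m′) x =
    trans (subwordProd-reject w P (outside (s≤s (≤′⇒≤ m≤′m′))) x) (go m≤′m′ x)

length-concat-map : ∀ (f : ℕ → List ℕ) xs → length (concat (map f xs)) ≡ sum (map (length ∘ f) xs)
length-concat-map f [] = refl
length-concat-map f (x ∷ xs) = trans (length-++ (f x)) (cong (length (f x) +_) (length-concat-map f xs))

sum-map-filterᵇ-partition : ∀ (p : ℕ → Bool) (g : ℕ → ℕ) xs →
  sum (map g (filterᵇ p xs)) + sum (map g (filterᵇ (not ∘ p) xs)) ≡ sum (map g xs)
sum-map-filterᵇ-partition p g [] = refl
sum-map-filterᵇ-partition p g (x ∷ xs) with p x
... | true = trans (+-assoc (g x) _ _) (cong (g x +_) (sum-map-filterᵇ-partition p g xs))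
... | false = begin
  A + (g x + B)  ≡⟨ +-assoc A (g x) B ⟨
  (A + g x) + B  ≡⟨ cong (_+ B) (+-comm A (g x)) ⟩
  (g x + A) + B  ≡⟨ +-assoc (g x) A B ⟩
  g x + (A + B)  ≡⟨ cong (g x +_) (sum-map-filterᵇ-partition p g xs) ⟩
  g x + sum (map g xs) ∎
  where
  A = sum (map g (filterᵇ p xs))
  B = sum (map g (filterᵇ (not ∘ p) xs))

sum-upTo-suc : ∀ m → sum (upTo (suc m)) ≡ sum (upTo m) + m
sum-upTo-suc m = begin
  sum (upTo (suc m))          ≡⟨ cong sum (upTo-∷ʳ m) ⟨
  sum (upTo m ++ [ m ])       ≡⟨ sum-++ (upTo m) [ m ] ⟩
  sum (upTo m) + (m + 0)      ≡⟨ cong (sum (upTo m) +_) (+-identityʳ m) ⟩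
  sum (upTo m) + m            ∎

sum-pred-twoToN : ∀ n → sum (map (_∸ 1) (twoToN n)) + n ≡ Nn n
sum-pred-twoToN zero = refl
sum-pred-twoToN (suc k) = begin
  sum (map (_∸ 1) (applyUpTo (_+ 2) k)) + suc k   ≡⟨ cong (λ ks → sum ks + suc k) shift ⟩
  sum (applyUpTo suc k) + suc k                   ≡⟨ sum-upTo-suc (suc k) ⟨
  Nn (suc k)                                      ∎
  where
  shift : map (_∸ 1) (applyUpTo (_+ 2) k) ≡ applyUpTo suc k
  shift = begin
    map (_∸ 1) (applyUpTo (_+ 2) k)   ≡⟨ map-applyUpTo (_+ 2) (_∸ 1) k ⟩
    applyUpTo (λ j → j + 2 ∸ 1) k     ≡⟨ map-upTo (λ j → j + 2 ∸ 1) k ⟨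
    map (λ j → j + 2 ∸ 1) (upTo k)    ≡⟨ map-cong (λ j → cong (_∸ 1) (+-comm j 2)) (upTo k) ⟩
    map suc (upTo k)                  ≡⟨ map-upTo suc k ⟩
    applyUpTo suc k                   ∎

length-Rword : ∀ n a → length (Rword n a) ≡ Nn n
length-Rword n a = begin
  length (Rword n a)                              ≡⟨ length-++ lowerRuns ⟩
  length lowerRuns + length (down n ++ upperRuns) ≡⟨ cong₂ _+_ length-lowerRuns (length-++ (down n)) ⟩
  Σd + (length (down n) + length upperRuns)       ≡⟨ cong (Σd +_) (cong₂ _+_ (length-down n) length-upperRuns) ⟩
  Σd + (n + Σu)                                   ≡⟨ cong (Σd +_) (+-comm n Σu) ⟩
  Σd + (Σu + n)                                   ≡⟨ +-assoc Σd Σu n ⟨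
  (Σd + Σu) + n
    ≡⟨ cong (_+ n) (sum-map-filterᵇ-partition (lowerBarred a) (_∸ 1) (twoToN n)) ⟩
  sum (map (_∸ 1) (twoToN n)) + n                 ≡⟨ sum-pred-twoToN n ⟩
  Nn n                                            ∎
  where
  lowerRuns = concat (map (λ d → down (d ∸ 1)) (lowers n a))
  upperRuns = concat (map (upRun n) (reverse (uppers n a)))
  Σd = sum (map (_∸ 1) (lowers n a))
  Σu = sum (map (_∸ 1) (uppers n a))

  length-down : ∀ k → length (down k) ≡ k
  length-down k = trans (length-map _ (upTo k)) (length-upTo k)

  length-upRun : ∀ u → length (upRun n u) ≡ u ∸ 1
  length-upRun u = trans (length-map _ (upTo (u ∸ 1))) (length-upTo (u ∸ 1))

  length-lowerRuns : length lowerRuns ≡ Σd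
  length-lowerRuns = trans (length-concat-map _ (lowers n a)) (cong sum (map-cong (length-down ∘ (_∸ 1)) (lowers n a)))

  length-upperRuns : length upperRuns ≡ Σu
  length-upperRuns = begin
    length upperRuns                               ≡⟨ length-concat-map (upRun n) (reverse (uppers n a)) ⟩
    sum (map (length ∘ upRun n) (reverse (uppers n a)))
      ≡⟨ cong sum (map-cong length-upRun (reverse (uppers n a))) ⟩
    sum (map (_∸ 1) (reverse (uppers n a)))        ≡⟨ sum-↭ (map⁺ (_∸ 1) (↭-reverse (uppers n a))) ⟩
    Σu                                             ∎

allIn-sound : ∀ P c → allIn P c ≡ true → ∀ k → 0 < k → k ≤ c → P k ≡ true
allIn-sound P zero _ k 0<k k≤0 = contradiction k≤0 (<⇒≱ 0<k)
allIn-sound P (suc c) all k 0<k k≤1+c with P (suc c) in P[1+c] | m≤n⇒m<n∨m≡n k≤1+c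
... | true | inj₁ k<1+c = allIn-sound P c all k 0<k (m<1+n⇒m≤n k<1+c)
... | true | inj₂ refl = P[1+c]

findBelow-just : ∀ p c {o} → findBelow p c ≡ just o →
                 o < c × p o ≡ true × (∀ k → o < k → k < c → p k ≡ false)
findBelow-just p (suc c) {o} found with p c in pc
findBelow-just p (suc c) refl | true = ≤-refl , pc , λ k c<k k<1+c → contradiction (m<1+n⇒m≤n k<1+c) (<⇒≱ c<k)
findBelow-just p (suc c) {o} found | false with findBelow-just p c found
... | o<c , po , between = m≤n⇒m≤1+n o<c , po , between′
  where
  between′ : ∀ k → o < k → k < suc c → p k ≡ false
  between′ k o<k k<1+c with m<1+n⇒m<n∨m≡n k<1+c
  ... | inj₁ k<c = between k o<k k<c
  ... | inj₂ refl = pc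

findBelow-nothing : ∀ p c → findBelow p c ≡ nothing → ∀ k → k < c → p k ≡ false
findBelow-nothing p (suc c) none k k<1+c with p c in pc | m<1+n⇒m<n∨m≡n k<1+c
... | false | inj₁ k<c = findBelow-nothing p c none k k<c
... | false | inj₂ refl = pc

include-endpoint : ∀ {P : ℕ → Set} {o c} → (∀ k → o < k → k < c → P k) → P c →
                   ∀ k → o < k → k ≤ c → P k
include-endpoint inside Pc k o<k k≤c with m≤n⇒m<n∨m≡n k≤c
... | inj₁ k<c = inside k o<k k<c
... | inj₂ refl = Pc

jumps : (ℕ → ℤ) → (ℕ → Bool) → ℕ → ℤ
jumps F P zero = 0ℤ
jumps F P (suc m) = if P (suc m) then jumps F P m else (F (suc m) - F m) ℤ.+ jumps F P m

sumDiffs : (ℕ → ℤ) → List (ℕ × ℕ) → ℤ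
sumDiffs F [] = 0ℤ
sumDiffs F ((o , e) ∷ ps) = (F o - F e) ℤ.+ sumDiffs F ps

jumps-members : ∀ F P {o c} → o ≤ c → (∀ k → o < k → k ≤ c → P k ≡ true) → jumps F P c ≡ jumps F P o
jumps-members F P o≤c = go (≤⇒≤′ o≤c)
  where
  go : ∀ {o c} → o ≤′ c → (∀ k → o < k → k ≤ c → P k ≡ true) → jumps F P c ≡ jumps F P o
  go ≤′-refl _ = refl
  go (≤′-step {c} o≤′c) members rewrite members (suc c) (s≤s (≤′⇒≤ o≤′c)) ≤-refl =
    go o≤′c (λ k o<k k≤c → members k o<k (m≤n⇒m≤1+n k≤c))

jumps-gap : ∀ F P {e o} → e ≤ o → (∀ k → e < k → k ≤ o → P k ≡ false) →
            jumps F P o ≡ (F o - F e) ℤ.+ jumps F P e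
jumps-gap F P e≤o = go (≤⇒≤′ e≤o)
  where
  go : ∀ {e o} → e ≤′ o → (∀ k → e < k → k ≤ o → P k ≡ false) →
       jumps F P o ≡ (F o - F e) ℤ.+ jumps F P e
  go {e} ≤′-refl _ = sym (trans (cong (ℤ._+ jumps F P e) (+-inverseʳ (F e))) (+-identityˡ (jumps F P e)))
  go {e} (≤′-step {o} e≤′o) gap rewrite gap (suc o) (s≤s (≤′⇒≤ e≤′o)) ≤-refl = begin
    (F (suc o) - F o) ℤ.+ jumps F P o
      ≡⟨ cong (ℤ._+_ (F (suc o) - F o)) (go e≤′o (λ k e<k k≤o → gap k e<k (m≤n⇒m≤1+n k≤o))) ⟩
    (F (suc o) - F o) ℤ.+ ((F o - F e) ℤ.+ jumps F P e)
      ≡⟨ chain (F (suc o)) (F o) (F e) (jumps F P e) ⟩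
    (F (suc o) - F e) ℤ.+ jumps F P e ∎
    where
    chain : ∀ x y z j → (x - y) ℤ.+ ((y - z) ℤ.+ j) ≡ (x - z) ℤ.+ j
    chain = ℤ-Solver.solve-∀

no-member-below : ∀ (P : ℕ → Bool) {o} → P 1 ≡ true → P o ≡ false → findBelow P o ≡ nothing → o ≡ 0
no-member-below P {zero} _ _ _ = refl
no-member-below P {suc zero} P1 P1≡false _ = contradiction P1≡false (not-¬ P1)
no-member-below P {suc (suc o)} P1 _ none =
  contradiction (findBelow-nothing P (suc (suc o)) none 1 (s≤s (s≤s z≤n))) (not-¬ P1)

jumps-above-last-nonmember : ∀ F P {c o} → P c ≡ true → findBelow (not ∘ P) c ≡ just o →
                             jumps F P c ≡ jumps F P o
jumps-above-last-nonmember F P {c} Pc found with findBelow-just (not ∘ P) c found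
... | o<c , _ , above-o =
  jumps-members F P (<⇒≤ o<c) (include-endpoint (λ k o<k k<c → not-injective (above-o k o<k k<c)) Pc)

jumps-above-last-member : ∀ F P {o e} → P o ≡ false → findBelow P o ≡ just e →
                          jumps F P o ≡ (F o - F e) ℤ.+ jumps F P e
jumps-above-last-member F P {o} Po found with findBelow-just P o found
... | e<o , _ , between = jumps-gap F P (<⇒≤ e<o) (include-endpoint between Po)

member-positive : ∀ (P : ℕ → Bool) {c} → P 0 ≡ false → P c ≡ true → 0 < c
member-positive P {zero} P0 P0≡true = contradiction P0 (not-¬ P0≡true)
member-positive P {suc c} _ _ = s≤s z≤n

sumDiffs-steps≡jumps : ∀ F P → P 0 ≡ false → P 1 ≡ true →
                       ∀ fuel c → c ≤ fuel → P c ≡ true → sumDiffs F (steps fuel P c) ≡ jumps F P c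
sumDiffs-steps≡jumps F P P0 P1 zero zero _ P0≡true = contradiction P0 (not-¬ P0≡true)
sumDiffs-steps≡jumps F P P0 P1 (suc fuel) c c≤1+fuel Pc with allIn P c in all
... | true = sym (jumps-members F P z≤n (allIn-sound P c all))
... | false with findBelow (not ∘ P) c in below-c
...   | nothing = contradiction (findBelow-nothing (not ∘ P) c below-c 0 (member-positive P P0 Pc)) (not-¬ (cong not P0))
...   | just o with findBelow-just (not ∘ P) c below-c | findBelow P o in below-o
...     | o<c , ¬Po , _ | nothing = begin
  0ℤ           ≡⟨ cong (jumps F P) (no-member-below P P1 (not-injective ¬Po) below-o) ⟨
  jumps F P o  ≡⟨ jumps-above-last-nonmember F P Pc below-c ⟨
  jumps F P c  ∎
...     | o<c , ¬Po , _ | just e with findBelow-just P o below-o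
...       | e<o , Pe , _ = begin
  (F o - F e) ℤ.+ sumDiffs F (steps fuel P e)
    ≡⟨ cong (ℤ._+_ (F o - F e)) (sumDiffs-steps≡jumps F P P0 P1 fuel e e≤fuel Pe) ⟩
  (F o - F e) ℤ.+ jumps F P e                  ≡⟨ jumps-above-last-member F P (not-injective ¬Po) below-o ⟨
  jumps F P o                                  ≡⟨ jumps-above-last-nonmember F P Pc below-c ⟨
  jumps F P c                                  ∎
  where
  e≤fuel : e ≤ fuel
  e≤fuel = m<1+n⇒m≤n (<-≤-trans (<-trans e<o o<c) c≤1+fuel)

IsHeapIdeal : List ℕ → (ℕ → Bool) → Set
IsHeapIdeal w P = ∀ {x y} → 1 ≤ x → x < y → y ≤ length w →
                  ∣ nth1 w x - nth1 w y ∣ ≤ 1 → P y ≡ true → P x ≡ true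

module SubwordFactorisation (w : List ℕ) (I : ℕ → Bool) (ideal : IsHeapIdeal w I) where

  letter : ℕ → ℕ
  letter = nth1 w

  B W V : ℕ → ℕ → ℕ
  B m = prod (take m w)
  W = subwordProd w I
  V = subwordProd w (not ∘ I)

  V-fixes : ∀ m {y} → m < y → y ≤ length w → I y ≡ true → FixesSupport (V m) (letter y)
  V-fixes zero _ _ _ = fixes refl refl
  V-fixes (suc m) {y} m<y y≤∣w∣ Iy with I (suc m) in I[1+m]
  ... | true = fixesSupport-resp (subwordProd-reject w (not ∘ I) {m} (cong not I[1+m])) (V-fixes m m<y′ y≤∣w∣ Iy)
    where m<y′ = <-trans (n<1+n m) m<y
  ... | false = fixesSupport-resp (subwordProd-accept w (not ∘ I) {m} (cong not I[1+m]))
                  (fixesSupport-∘ (V-fixes m m<y′ y≤∣w∣ Iy) (far⇒s-fixes (letter (suc m)) (letter y) commuting))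
    where
    m<y′ = <-trans (n<1+n m) m<y
    commuting : ¬ ∣ letter (suc m) - letter y ∣ ≤ 1
    commuting close = not-¬ (ideal (s≤s z≤n) m<y y≤∣w∣ close Iy) I[1+m]

  V-commutes : ∀ {m} → I (suc m) ≡ true → suc m ≤ length w →
               ∀ x → V m (s (letter (suc m)) x) ≡ s (letter (suc m)) (V m x)
  V-commutes {m} I[1+m] 1+m≤∣w∣ =
    commutes-with-s (subwordProd-injective w (not ∘ I) m) (V-fixes m (n<1+n m) 1+m≤∣w∣ I[1+m])

  factorisation : ∀ m → m ≤ length w → ∀ x → B m x ≡ W m (V m x)
  factorisation zero _ x = refl
  factorisation (suc m) 1+m≤∣w∣ x with I (suc m) in I[1+m]
  ... | true = begin
    B (suc m) x                ≡⟨ prod-take-suc w m 1+m≤∣w∣ x ⟩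
    B m (s r x)                ≡⟨ factorisation m m≤∣w∣ (s r x) ⟩
    W m (V m (s r x))          ≡⟨ cong (W m) (V-commutes I[1+m] 1+m≤∣w∣ x) ⟩
    W m (s r (V m x))          ≡⟨ subwordProd-accept w I I[1+m] (V m x) ⟨
    W (suc m) (V m x)          ≡⟨ cong (W (suc m)) (subwordProd-reject w (not ∘ I) {m} (cong not I[1+m]) x) ⟨
    W (suc m) (V (suc m) x)    ∎
    where
    r = letter (suc m)
    m≤∣w∣ = <⇒≤ 1+m≤∣w∣
  ... | false = begin
    B (suc m) x                ≡⟨ prod-take-suc w m 1+m≤∣w∣ x ⟩
    B m (s r x)                ≡⟨ factorisation m (<⇒≤ 1+m≤∣w∣) (s r x) ⟩
    W m (V m (s r x))          ≡⟨ cong (W m) (subwordProd-accept w (not ∘ I) {m} (cong not I[1+m]) x) ⟨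
    W m (V (suc m) x)          ≡⟨ subwordProd-reject w I I[1+m] (V (suc m) x) ⟨
    W (suc m) (V (suc m) x)    ∎
    where
    r = letter (suc m)

  module _ (g : ℕ → ℤ) where

    discrepancy : ℕ → ℕ → ℤ
    discrepancy m x = g (B m x) - g (W m x)

    discrepancy-at-fixed-point : ∀ {m x} → m ≤ length w → V m x ≡ x → discrepancy m x ≡ 0ℤ
    discrepancy-at-fixed-point {m} {x} m≤∣w∣ Vx≡x = begin
      g (B m x) - g (W m x)
        ≡⟨ cong (λ v → g v - g (W m x)) (trans (factorisation m m≤∣w∣ x) (cong (W m) Vx≡x)) ⟩
      g (W m x) - g (W m x)   ≡⟨ +-inverseʳ (g (W m x)) ⟩
      0ℤ                      ∎

    discrepancy-member : ∀ {m} → I (suc m) ≡ true → suc m ≤ length w →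
                         ∀ x → discrepancy (suc m) x ≡ discrepancy m x
    discrepancy-member {m} I[1+m] 1+m≤∣w∣ x = begin
      discrepancy (suc m) x
        ≡⟨ cong₂ (λ u v → g u - g v) (prod-take-suc w m 1+m≤∣w∣ x) (subwordProd-accept w I I[1+m] x) ⟩
      discrepancy m (s r x)  ≡⟨ s-invariant (discrepancy m) r (trans (vanishes fixes-r) (sym (vanishes fixes-1+r))) x ⟩
      discrepancy m x        ∎
      where
      r = letter (suc m)
      open FixesSupport (V-fixes m (n<1+n m) 1+m≤∣w∣ I[1+m])
      vanishes : ∀ {y} → V m y ≡ y → discrepancy m y ≡ 0ℤ
      vanishes = discrepancy-at-fixed-point (<⇒≤ 1+m≤∣w∣)

    discrepancy-nonmember : ∀ {m} → I (suc m) ≡ false → ∀ x →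
                            discrepancy (suc m) x ≡ (g (B (suc m) x) - g (B m x)) ℤ.+ discrepancy m x
    discrepancy-nonmember {m} I[1+m] x = begin
      g (B (suc m) x) - g (W (suc m) x)  ≡⟨ cong (λ v → g (B (suc m) x) - g v) (subwordProd-reject w I I[1+m] x) ⟩
      g (B (suc m) x) - g (W m x)        ≡⟨ split (g (B (suc m) x)) (g (B m x)) (g (W m x)) ⟩
      (g (B (suc m) x) - g (B m x)) ℤ.+ discrepancy m x ∎
      where
      split : ∀ a b c → a - c ≡ (a - b) ℤ.+ (b - c)
      split = ℤ-Solver.solve-∀

    discrepancy≡jumps : ∀ m → m ≤ length w → ∀ x → discrepancy m x ≡ jumps (λ k → g (B k x)) I m
    discrepancy≡jumps zero _ x = +-inverseʳ (g x)
    discrepancy≡jumps (suc m) 1+m≤∣w∣ x with I (suc m) in I[1+m]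
    ... | true = trans (discrepancy-member I[1+m] 1+m≤∣w∣ x) (discrepancy≡jumps m (<⇒≤ 1+m≤∣w∣) x)
    ... | false = trans (discrepancy-nonmember I[1+m] x)
                        (cong (ℤ._+_ (g (B (suc m) x) - g (B m x))) (discrepancy≡jumps m (<⇒≤ 1+m≤∣w∣) x))

orderIdeal⇒heapIdeal : ∀ {n a I} → IsOrderIdeal n a I → IsHeapIdeal (Rword n a) I
orderIdeal⇒heapIdeal {n} {a} (_ , lower) 1≤x x<y y≤∣w∣ close Iy =
  lower _ _ [ 1≤x , x<y , subst (_ ≤_) (length-Rword n a) y≤∣w∣ , close ]⁺ Iy

orderIdeal-excludes-0 : ∀ {n a I} → IsOrderIdeal n a I → I 0 ≡ false
orderIdeal-excludes-0 {I = I} (support , _) with I 0 in I0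
... | false = refl
... | true = contradiction (proj₁ (support 0 I0)) λ ()

corr≡sumDiffs : ∀ n a ps i j → corr n a ps i j ≡ sumDiffs (λ k → X n (b n a k) i j) ps
corr≡sumDiffs n a [] i j = refl
corr≡sumDiffs n a ((o , e) ∷ ps) i j =
  cong (ℤ._+_ (X n (b n a o) i j - X n (b n a e) i j)) (corr≡sumDiffs n a ps i j)

lemma6p29 : (n : ℕ) (a : List ℕ) → a ↭ map suc (upTo n) →
            (I : ℕ → Bool) → IsOrderIdeal n a I → I 1 ≡ true →
            (a0 : ℕ) → I a0 ≡ true → ((m : ℕ) → I m ≡ true → m ≤ a0) →
            (i j : Fin (suc n)) →
            X n (singletonOf n a I) i j
              ≡ X n (b n a a0) i j - corr n a (oddEven I a0) i j
lemma6p29 n a _ I ideal I1 a0 Ia0 a0-max i j = begin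
  X n (singletonOf n a I) i j                       ≡⟨ cong g (subwordProd-beyond w I a0-max a0≤N p) ⟩
  g (W a0 p)                                        ≡⟨ cancel (g (B a0 p)) (g (W a0 p)) ⟩
  g (B a0 p) - discrepancy g a0 p                   ≡⟨ cong (g (B a0 p) -_) (discrepancy≡jumps g a0 a0≤∣w∣ p) ⟩
  g (B a0 p) - jumps F I a0                         ≡⟨ cong (g (B a0 p) -_) telescope ⟨
  g (B a0 p) - sumDiffs F (oddEven I a0)            ≡⟨ cong (g (B a0 p) -_) (corr≡sumDiffs n a (oddEven I a0) i j) ⟨
  X n (b n a a0) i j - corr n a (oddEven I a0) i j  ∎
  where
  w = Rword n a
  open SubwordFactorisation w I (orderIdeal⇒heapIdeal {n} {a} ideal)
  p = suc (toℕ i)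
  g : ℕ → ℤ
  g v = if v ≡ᵇ suc (toℕ j) then 1ℤ else 0ℤ
  F : ℕ → ℤ
  F k = g (B k p)
  a0≤N : a0 ≤ Nn n
  a0≤N = proj₂ (proj₁ ideal a0 Ia0)
  a0≤∣w∣ : a0 ≤ length w
  a0≤∣w∣ = subst (a0 ≤_) (sym (length-Rword n a)) a0≤N
  telescope : sumDiffs F (oddEven I a0) ≡ jumps F I a0
  telescope = sumDiffs-steps≡jumps F I (orderIdeal-excludes-0 {n} {a} ideal) I1 a0 a0 ≤-refl Ia0
  cancel : ∀ x y → y ≡ x - (x - y)
  cancel = ℤ-Solver.solve-∀
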